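{- Let $p$ be a prime and let $L=\{l_1,\ldots,l_s\}$ and $K=\{k_1,\ldots,k_r\}$ be subsets of $\{0,1,\ldots,p-1\}$ with $L\cap K=\emptyset$. Let $\mathcal{A}=\{A_1,\ldots,A_m\}$ be a family of subsets of $[n]$ such that $|A_i|\pmod p\in K$ for every $i$ and $|A_i\cap A_j|\pmod p\in L$ for all $i\neq j$. Let $X=[n-1]$. Introduce variables $x_1,\ldots,x_m$ (one for each $A_i$) and for each $I\subseteq X$ define the linear form $L_I=\sum_{i:\, I\subseteq A_i} x_i$ over $\mathbb{F}_p$. Then the only solution $(x_1,\ldots,x_m)\in\mathbb{F}_p^m$ of the system of linear equations $\{L_I=0 : I\subseteq X,\ |I|\le s\}$ is the trivial solution $x=0$. -}

module Defs where

open import Data.Nat using (ℕ; zero; suc; _+_; _<_)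
open import Data.Fin using (Fin; toℕ; zero; suc)
open import Data.Fin.Subset using (Subset; _⊆_; _∈_)
open import Data.Fin.Subset.Properties using (_⊆?_)
open import Relation.Nullary using (does)
open import Data.Bool using (if_then_else_)

sumFin : (m : ℕ) → (Fin m → ℕ) → ℕ
sumFin zero    f = 0
sumFin (suc m) f = f zero + sumFin m (λ i → f (suc i))

-- Elements of [n] = {1,...,n} are represented by j : Fin n (j stands for toℕ j + 1).
-- I ⊆ X = [n-1]  iff every element of I is at most n-1, i.e. suc (toℕ j) < n.
SubsetOfX : (n : ℕ) → Subset n → Set
SubsetOfX n I = ∀ j → j ∈ I → suc (toℕ j) < n

-- The linear form L_I = Σ_{i : I ⊆ A_i} x_i, computed on representatives in ℕ
-- (x_i ∈ F_p represented by Fin p); it vanishes in F_p iff p divides this value.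
linForm : ∀ {n m p} → (Fin m → Subset n) → (Fin m → Fin p) → Subset n → ℕ
linForm {m = m} A x I = sumFin m (λ i → if does (I ⊆? A i) then toℕ (x i) else 0)

-- Fix j. The function F(C) = ∏_{l ∈ L} (|C ∩ Aⱼ| − l) is a polynomial of degree |L| = s in
-- the characteristic vector of C, hence a combination of monomials χ J with |J| ≤ s, so the
-- equations L_J = 0 give Σᵢ xᵢ F(Aᵢ) ≡ 0 (mod p). Now F(Aᵢ) ≡ 0 for i ≢ j, as |Aᵢ ∩ Aⱼ| mod p
-- lies in L, while F(Aⱼ) ≢ 0, as |Aⱼ| mod p lies in K; so xⱼ = 0. Only monomials avoiding the
-- element n are available, so this works directly when n ∉ Aⱼ. When n ∈ Aⱼ one uses
-- |C ∩ (Aⱼ − n)| + 1 instead of |C ∩ Aⱼ|: the two agree on every Aᵢ ∋ n, and all Aᵢ ∌ n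
-- already carry xᵢ = 0.

module Submission where

open import Defs
open import Data.Bool using (true; false; if_then_else_)
open import Data.Fin using (Fin; zero; suc; toℕ; fromℕ; punchIn)
open import Data.Fin.Properties using (toℕ<n; toℕ≤pred[n]; toℕ-injective; toℕ-fromℕ; punchInᵢ≢i)
open import Data.Fin.Subset using (Subset; inside; outside; _∈_; _∉_; _⊆_; _∩_; _∪_; _-_; ⁅_⁆; ⊥; ∣_∣)
open import Data.Fin.Subset.Properties
  using ( _∈?_; _⊆?_; x∈p∩q⁺; x∈p∩q⁻; x∈p∪q⁻; p⊆p∪q; q⊆p∪q; x∈⁅x⁆; x∈⁅y⁆⇒x≡y; ∣⁅x⁆∣≡1
        ; ⊥⊆; ∉⊥; ∣⊥∣≡0; ∩-idem; p─⊥≡p)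
open import Data.Nat using (ℕ; zero; suc; _+_; _*_; _∸_; _≤_; _<_; _%_; _/_; NonZero; z≤n; s≤s)
open import Data.Nat.Properties
open import Algebra.Properties.Semiring.Sum +-*-semiring
  using (sum; sum-syntax; sum-cong-≗; ∑-distrib-+; ∑-comm; *-distribˡ-sum; *-distribʳ-sum; sum-remove)
open import Data.Nat.Tactic.RingSolver using (solve-∀)
open import Algebra.Properties.CommutativeSemigroup *-commutativeSemigroup
  using () renaming (x∙yz≈y∙xz to x*[y*z]≡y*[x*z])
open import Algebra.Properties.CommutativeSemigroup +-commutativeSemigroup
  using () renaming (xy∙z≈xz∙y to [x+y]+z≡[x+z]+y)
open import Data.Nat.DivMod using (m≡m%n+[m/n]*n; [m+n]%n≡m%n; %-remove-+ˡ; m<n⇒m%n≡m)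
open import Data.Nat.Divisibility
  using (_∣_; _∤_; divides; _∣0; ∣m∣n⇒∣m+n; ∣m+n∣m⇒∣n; ∣m⇒∣m*n; ∣n⇒∣m*n; ∣1⇒≡1; >⇒∤)
open import Data.Nat.Primality using (Prime; euclidsLemma; ¬prime[1])
open import Data.Product using (∃; _×_; _,_)
open import Data.Sum using (_⊎_; inj₁; inj₂; [_,_])
open import Data.Vec using (_∷_; []; here; there)
open import Data.Vec.Functional using (removeAt)
open import Function using (id; _∘_; _⇔_; mk⇔)
open import Relation.Nullary using (Dec; does; yes; no; contradiction)
open import Relation.Nullary.Decidable using (_×-dec_; does-⇔; dec-true)
open import Relation.Binary.PropositionalEquality
  using (_≡_; _≢_; refl; sym; trans; cong; cong₂; subst; module ≡-Reasoning)
open ≡-Reasoning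

sumFin≡∑ : ∀ m (f : Fin m → ℕ) → sumFin m f ≡ ∑[ i < m ] f i
sumFin≡∑ zero    f = refl
sumFin≡∑ (suc m) f = cong (f zero +_) (sumFin≡∑ m (f ∘ suc))

∣-∑ : ∀ {d m} (f : Fin m → ℕ) → (∀ i → d ∣ f i) → d ∣ ∑[ i < m ] f i
∣-∑ {d} {zero}  f d∣f = d ∣0
∣-∑ {d} {suc m} f d∣f = ∣m∣n⇒∣m+n (d∣f zero) (∣-∑ (f ∘ suc) (d∣f ∘ suc))

∣-∑⇒∣-term : ∀ {d m} (f : Fin m → ℕ) j → (∀ i → i ≢ j → d ∣ f i) → d ∣ ∑[ i < m ] f i → d ∣ f j
∣-∑⇒∣-term {d} {suc m} f j d∣others d∣∑ = ∣m+n∣m⇒∣n d∣∑′ d∣rest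
  where
  d∣rest : d ∣ sum (removeAt f j)
  d∣rest = ∣-∑ (removeAt f j) (λ k → d∣others (punchIn j k) (punchInᵢ≢i j k))
  d∣∑′ : d ∣ sum (removeAt f j) + f j
  d∣∑′ = subst (d ∣_) (trans (sum-remove {i = j} f) (+-comm (f j) _)) d∣∑

𝟙[_] : ∀ {a} {A : Set a} → Dec A → ℕ
𝟙[ a? ] = if does a? then 1 else 0

𝟙-⇔ : ∀ {a b} {A : Set a} {B : Set b} → A ⇔ B → (a? : Dec A) (b? : Dec B) → 𝟙[ a? ] ≡ 𝟙[ b? ]
𝟙-⇔ A⇔B a? b? = cong (λ t → if t then 1 else 0) (does-⇔ A⇔B a? b?)

𝟙-×-dec : ∀ {a b} {A : Set a} {B : Set b} (a? : Dec A) (b? : Dec B) → 𝟙[ a? ×-dec b? ] ≡ 𝟙[ a? ] * 𝟙[ b? ]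
𝟙-×-dec (yes _) (yes _) = refl
𝟙-×-dec (yes _) (no _)  = refl
𝟙-×-dec (no _)  _       = refl

∣p∣≡∑𝟙[∈] : ∀ {n} (p : Subset n) → ∣ p ∣ ≡ ∑[ a < n ] 𝟙[ a ∈? p ]
∣p∣≡∑𝟙[∈] []            = refl
∣p∣≡∑𝟙[∈] (inside  ∷ p) = cong suc (∣p∣≡∑𝟙[∈] p)
∣p∣≡∑𝟙[∈] (outside ∷ p) = ∣p∣≡∑𝟙[∈] p

𝟙[∈∩] : ∀ {n} (a : Fin n) (p q : Subset n) → 𝟙[ a ∈? p ∩ q ] ≡ 𝟙[ a ∈? p ] * 𝟙[ a ∈? q ]
𝟙[∈∩] a p q = trans (𝟙-⇔ (mk⇔ (x∈p∩q⁻ p q) x∈p∩q⁺) (a ∈? p ∩ q) (a ∈? p ×-dec a ∈? q))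
                     (𝟙-×-dec (a ∈? p) (a ∈? q))

-- The monomial ∏_{j ∈ J} cⱼ evaluated at the characteristic vector c of C.
χ : ∀ {n} → Subset n → Subset n → ℕ
χ J C = 𝟙[ J ⊆? C ]

χ-⊥ : ∀ {n} (C : Subset n) → χ ⊥ C ≡ 1
χ-⊥ C = cong (λ t → if t then 1 else 0) (dec-true (⊥ ⊆? C) ⊥⊆)

∪⁅⁆⊆⇔ : ∀ {n} {J C : Subset n} {a : Fin n} → J ∪ ⁅ a ⁆ ⊆ C ⇔ (J ⊆ C × a ∈ C)
∪⁅⁆⊆⇔ {J = J} {C} {a} = mk⇔ to from
  where
  to : J ∪ ⁅ a ⁆ ⊆ C → J ⊆ C × a ∈ C
  to J∪a⊆C = J∪a⊆C ∘ p⊆p∪q ⁅ a ⁆ , J∪a⊆C (q⊆p∪q J ⁅ a ⁆ (x∈⁅x⁆ a))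
  from : J ⊆ C × a ∈ C → J ∪ ⁅ a ⁆ ⊆ C
  from (J⊆C , a∈C) x∈J∪a =
    [ J⊆C , (λ x∈⁅a⁆ → subst (_∈ C) (sym (x∈⁅y⁆⇒x≡y a x∈⁅a⁆)) a∈C) ] (x∈p∪q⁻ J ⁅ a ⁆ x∈J∪a)

χ-∪⁅⁆ : ∀ {n} (J C : Subset n) (a : Fin n) → χ (J ∪ ⁅ a ⁆) C ≡ χ J C * 𝟙[ a ∈? C ]
χ-∪⁅⁆ J C a = trans (𝟙-⇔ ∪⁅⁆⊆⇔ (J ∪ ⁅ a ⁆ ⊆? C) (J ⊆? C ×-dec a ∈? C))
                    (𝟙-×-dec (J ⊆? C) (a ∈? C))

χ*∣∩∣≡∑χ-∪⁅⁆ : ∀ {n} (J B C : Subset n) →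
               χ J C * ∣ C ∩ B ∣ ≡ ∑[ a < n ] (𝟙[ a ∈? B ] * χ (J ∪ ⁅ a ⁆) C)
χ*∣∩∣≡∑χ-∪⁅⁆ {n} J B C = begin
  χ J C * ∣ C ∩ B ∣                      ≡⟨ cong (χ J C *_) (∣p∣≡∑𝟙[∈] (C ∩ B)) ⟩
  χ J C * (∑[ a < n ] 𝟙[ a ∈? C ∩ B ]) ≡⟨ *-distribˡ-sum (χ J C) (λ a → 𝟙[ a ∈? C ∩ B ]) ⟩
  ∑[ a < n ] (χ J C * 𝟙[ a ∈? C ∩ B ]) ≡⟨ sum-cong-≗ term ⟩
  ∑[ a < n ] (𝟙[ a ∈? B ] * χ (J ∪ ⁅ a ⁆) C) ∎
  where
  term : ∀ a → χ J C * 𝟙[ a ∈? C ∩ B ] ≡ 𝟙[ a ∈? B ] * χ (J ∪ ⁅ a ⁆) C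
  term a = begin
    χ J C * 𝟙[ a ∈? C ∩ B ]                ≡⟨ cong (χ J C *_) (𝟙[∈∩] a C B) ⟩
    χ J C * (𝟙[ a ∈? C ] * 𝟙[ a ∈? B ])    ≡⟨ *-assoc (χ J C) _ _ ⟨
    χ J C * 𝟙[ a ∈? C ] * 𝟙[ a ∈? B ]      ≡⟨ cong (_* 𝟙[ a ∈? B ]) (χ-∪⁅⁆ J C a) ⟨
    χ (J ∪ ⁅ a ⁆) C * 𝟙[ a ∈? B ]          ≡⟨ *-comm (χ (J ∪ ⁅ a ⁆) C) _ ⟩
    𝟙[ a ∈? B ] * χ (J ∪ ⁅ a ⁆) C          ∎

∣p∪q∣≤∣p∣+∣q∣ : ∀ {n} (p q : Subset n) → ∣ p ∪ q ∣ ≤ ∣ p ∣ + ∣ q ∣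
∣p∪q∣≤∣p∣+∣q∣ []            []            = z≤n
∣p∪q∣≤∣p∣+∣q∣ (inside  ∷ p) (inside  ∷ q) =
  s≤s (≤-trans (∣p∪q∣≤∣p∣+∣q∣ p q) (+-monoʳ-≤ ∣ p ∣ (n≤1+n ∣ q ∣)))
∣p∪q∣≤∣p∣+∣q∣ (inside  ∷ p) (outside ∷ q) = s≤s (∣p∪q∣≤∣p∣+∣q∣ p q)
∣p∪q∣≤∣p∣+∣q∣ (outside ∷ p) (inside  ∷ q) =
  ≤-trans (s≤s (∣p∪q∣≤∣p∣+∣q∣ p q)) (≤-reflexive (sym (+-suc ∣ p ∣ ∣ q ∣)))
∣p∪q∣≤∣p∣+∣q∣ (outside ∷ p) (outside ∷ q) = ∣p∪q∣≤∣p∣+∣q∣ p q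

∣p∩q∣≡1+∣p∩[q-x]∣ : ∀ {n} {p q : Subset n} {x} → x ∈ p → x ∈ q → ∣ p ∩ q ∣ ≡ suc ∣ p ∩ (q - x) ∣
∣p∩q∣≡1+∣p∩[q-x]∣ {p = inside ∷ p} {inside ∷ q} here here = cong (λ r → suc ∣ p ∩ r ∣) (sym (p─⊥≡p q))
∣p∩q∣≡1+∣p∩[q-x]∣ {p = outside ∷ _} {_       ∷ _} (there x∈p) (there x∈q) = ∣p∩q∣≡1+∣p∩[q-x]∣ x∈p x∈q
∣p∩q∣≡1+∣p∩[q-x]∣ {p = inside  ∷ _} {inside  ∷ _} (there x∈p) (there x∈q) = cong suc (∣p∩q∣≡1+∣p∩[q-x]∣ x∈p x∈q)
∣p∩q∣≡1+∣p∩[q-x]∣ {p = inside  ∷ _} {outside ∷ _} (there x∈p) (there x∈q) = ∣p∩q∣≡1+∣p∩[q-x]∣ x∈p x∈q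

x∉p-x : ∀ {n} (p : Subset n) x → x ∉ p - x
x∉p-x (_ ∷ p) zero    ()
x∉p-x (_ ∷ p) (suc x) (there x∈p-x) = x∉p-x p x x∈p-x

SubsetOfX-∪⁅⁆ : ∀ {n} {J : Subset n} {a : Fin n} →
                SubsetOfX n J → suc (toℕ a) < n → SubsetOfX n (J ∪ ⁅ a ⁆)
SubsetOfX-∪⁅⁆ {n} {J} {a} J⊆X a∈X j j∈J∪a =
  [ J⊆X j , (λ j∈⁅a⁆ → subst (λ i → suc (toℕ i) < n) (sym (x∈⁅y⁆⇒x≡y a j∈⁅a⁆)) a∈X) ] (x∈p∪q⁻ J ⁅ a ⁆ j∈J∪a)

fromℕ∉⇒SubsetOfX : ∀ {k} {C : Subset (suc k)} → fromℕ k ∉ C → SubsetOfX (suc k) C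
fromℕ∉⇒SubsetOfX {k} {C} last∉C j j∈C = s≤s (≤∧≢⇒< (toℕ≤pred[n] j) toℕj≢k)
  where
  toℕj≢k : toℕ j ≢ k
  toℕj≢k toℕj≡k = last∉C (subst (_∈ C) (toℕ-injective (trans toℕj≡k (sym (toℕ-fromℕ k)))) j∈C)

∏∈ : ∀ {r} → Subset r → (Fin r → ℕ) → ℕ
∏∈ []            g = 1
∏∈ (inside  ∷ S) g = g zero * ∏∈ S (g ∘ suc)
∏∈ (outside ∷ S) g = ∏∈ S (g ∘ suc)

∣∏∈ : ∀ {r d} {S : Subset r} (g : Fin r → ℕ) {l} → l ∈ S → d ∣ g l → d ∣ ∏∈ S g
∣∏∈ {S = inside  ∷ S} g here        d∣gl = ∣m⇒∣m*n (∏∈ S (g ∘ suc)) d∣gl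
∣∏∈ {S = inside  ∷ S} g (there l∈S) d∣gl = ∣n⇒∣m*n (g zero) (∣∏∈ (g ∘ suc) l∈S d∣gl)
∣∏∈ {S = outside ∷ S} g (there l∈S) d∣gl = ∣∏∈ (g ∘ suc) l∈S d∣gl

prime∤∏∈ : ∀ {r d} → Prime d → (S : Subset r) (g : Fin r → ℕ) → (∀ l → l ∈ S → d ∤ g l) → d ∤ ∏∈ S g
prime∤∏∈ d-prime []            g d∤g d∣1 = ¬prime[1] (subst Prime (∣1⇒≡1 d∣1) d-prime)
prime∤∏∈ d-prime (inside  ∷ S) g d∤g d∣∏ =
  [ d∤g zero here , prime∤∏∈ d-prime S (g ∘ suc) (λ l l∈S → d∤g (suc l) (there l∈S)) ]
    (euclidsLemma (g zero) (∏∈ S (g ∘ suc)) d-prime d∣∏)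
prime∤∏∈ d-prime (outside ∷ S) g d∤g =
  prime∤∏∈ d-prime S (g ∘ suc) (λ l l∈S → d∤g (suc l) (there l∈S))

module Weighted {S : Set} {m} (w : Fin m → ℕ) (A : Fin m → S) where

  Φ : (S → ℕ) → ℕ
  Φ g = ∑[ i < m ] (w i * g (A i))

  Φ-cong : ∀ {g h : S → ℕ} → (∀ C → g C ≡ h C) → Φ g ≡ Φ h
  Φ-cong g≗h = sum-cong-≗ (λ i → cong (w i *_) (g≗h (A i)))

  Φ-+ : ∀ (g h : S → ℕ) → Φ (λ C → g C + h C) ≡ Φ g + Φ h
  Φ-+ g h = trans (sum-cong-≗ (λ i → *-distribˡ-+ (w i) (g (A i)) (h (A i))))
                  (∑-distrib-+ (λ i → w i * g (A i)) (λ i → w i * h (A i)))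

  Φ-* : ∀ c (g : S → ℕ) → Φ (λ C → c * g C) ≡ c * Φ g
  Φ-* c g = trans (sum-cong-≗ (λ i → x*[y*z]≡y*[x*z] (w i) c (g (A i))))
                  (sym (*-distribˡ-sum c (λ i → w i * g (A i))))

  Φ-∑ : ∀ {k} (g : Fin k → S → ℕ) → Φ (λ C → ∑[ a < k ] g a C) ≡ ∑[ a < k ] Φ (g a)
  Φ-∑ g = trans (sum-cong-≗ (λ i → *-distribˡ-sum (w i) (λ a → g a (A i))))
                (∑-comm (λ i a → w i * g a (A i)))

module Vanishing {q n m} (w : Fin m → ℕ) (A : Fin m → Subset n) (s : ℕ)
  (relations : ∀ J → SubsetOfX n J → ∣ J ∣ ≤ s → q ∣ Weighted.Φ w A (χ J)) where

  open Weighted w A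

  -- h acts like a polynomial of degree ≤ k in the characteristic vector of C.
  Vanishes : ℕ → (Subset n → ℕ) → Set
  Vanishes k h = ∀ J → SubsetOfX n J → ∣ J ∣ + k ≤ s → q ∣ Φ (λ C → χ J C * h C)

  vanishes-1 : Vanishes 0 (λ _ → 1)
  vanishes-1 J J⊆X ∣J∣+0≤s =
    subst (q ∣_) (Φ-cong (λ C → sym (*-identityʳ (χ J C))))
      (relations J J⊆X (subst (_≤ s) (+-identityʳ ∣ J ∣) ∣J∣+0≤s))

  vanishes-*-∣∩∣+ : ∀ {k h} {B : Subset n} o → SubsetOfX n B → Vanishes k h →
                    Vanishes (suc k) (λ C → (∣ C ∩ B ∣ + o) * h C)
  vanishes-*-∣∩∣+ {k} {h} {B} o B⊆X vanishes J J⊆X ∣J∣+1+k≤s = subst (q ∣_) (sym expansion) q∣expansion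
    where
    χ∪h : Fin n → Subset n → ℕ
    χ∪h a C = χ (J ∪ ⁅ a ⁆) C * h C

    χh : Subset n → ℕ
    χh C = χ J C * h C

    pointwise : ∀ C → χ J C * ((∣ C ∩ B ∣ + o) * h C) ≡ ∑[ a < n ] (𝟙[ a ∈? B ] * χ∪h a C) + o * χh C
    pointwise C = begin
      χ J C * ((∣ C ∩ B ∣ + o) * h C)
        ≡⟨ distrib (χ J C) ∣ C ∩ B ∣ o (h C) ⟩
      χ J C * ∣ C ∩ B ∣ * h C + o * χh C
        ≡⟨ cong (λ t → t * h C + o * χh C) (χ*∣∩∣≡∑χ-∪⁅⁆ J B C) ⟩
      (∑[ a < n ] (𝟙[ a ∈? B ] * χ (J ∪ ⁅ a ⁆) C)) * h C + o * χh C
        ≡⟨ cong (_+ o * χh C) (*-distribʳ-sum (h C) (λ a → 𝟙[ a ∈? B ] * χ (J ∪ ⁅ a ⁆) C)) ⟩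
      ∑[ a < n ] (𝟙[ a ∈? B ] * χ (J ∪ ⁅ a ⁆) C * h C) + o * χh C
        ≡⟨ cong (_+ o * χh C) (sum-cong-≗ (λ a → *-assoc 𝟙[ a ∈? B ] (χ (J ∪ ⁅ a ⁆) C) (h C))) ⟩
      ∑[ a < n ] (𝟙[ a ∈? B ] * χ∪h a C) + o * χh C ∎
      where
      distrib : ∀ x t o y → x * ((t + o) * y) ≡ x * t * y + o * (x * y)
      distrib = solve-∀

    expansion : Φ (λ C → χ J C * ((∣ C ∩ B ∣ + o) * h C))
              ≡ ∑[ a < n ] (𝟙[ a ∈? B ] * Φ (χ∪h a)) + o * Φ χh
    expansion = begin
      Φ (λ C → χ J C * ((∣ C ∩ B ∣ + o) * h C))
        ≡⟨ Φ-cong pointwise ⟩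
      Φ (λ C → ∑[ a < n ] (𝟙[ a ∈? B ] * χ∪h a C) + o * χh C)
        ≡⟨ Φ-+ (λ C → ∑[ a < n ] (𝟙[ a ∈? B ] * χ∪h a C)) (λ C → o * χh C) ⟩
      Φ (λ C → ∑[ a < n ] (𝟙[ a ∈? B ] * χ∪h a C)) + Φ (λ C → o * χh C)
        ≡⟨ cong (_+ Φ (λ C → o * χh C)) (Φ-∑ (λ a C → 𝟙[ a ∈? B ] * χ∪h a C)) ⟩
      ∑[ a < n ] Φ (λ C → 𝟙[ a ∈? B ] * χ∪h a C) + Φ (λ C → o * χh C)
        ≡⟨ cong₂ _+_ (sum-cong-≗ (λ a → Φ-* 𝟙[ a ∈? B ] (χ∪h a))) (Φ-* o χh) ⟩
      ∑[ a < n ] (𝟙[ a ∈? B ] * Φ (χ∪h a)) + o * Φ χh ∎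

    ∣J∪⁅a⁆∣+k≤s : ∀ a → ∣ J ∪ ⁅ a ⁆ ∣ + k ≤ s
    ∣J∪⁅a⁆∣+k≤s a =
      ≤-trans (+-monoˡ-≤ k ∣J∪⁅a⁆∣≤1+∣J∣) (≤-trans (≤-reflexive (sym (+-suc ∣ J ∣ k))) ∣J∣+1+k≤s)
      where
      ∣J∪⁅a⁆∣≤1+∣J∣ : ∣ J ∪ ⁅ a ⁆ ∣ ≤ suc ∣ J ∣
      ∣J∪⁅a⁆∣≤1+∣J∣ = ≤-trans (∣p∪q∣≤∣p∣+∣q∣ J ⁅ a ⁆)
                              (≤-reflexive (trans (cong (∣ J ∣ +_) (∣⁅x⁆∣≡1 a)) (+-comm ∣ J ∣ 1)))

    q∣Φ∪ : ∀ a → q ∣ 𝟙[ a ∈? B ] * Φ (χ∪h a)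
    q∣Φ∪ a with a ∈? B
    ... | yes a∈B = ∣n⇒∣m*n 1 (vanishes (J ∪ ⁅ a ⁆) (SubsetOfX-∪⁅⁆ J⊆X (B⊆X a a∈B)) (∣J∪⁅a⁆∣+k≤s a))
    ... | no  _   = q ∣0

    q∣expansion : q ∣ ∑[ a < n ] (𝟙[ a ∈? B ] * Φ (χ∪h a)) + o * Φ χh
    q∣expansion = ∣m∣n⇒∣m+n (∣-∑ (λ a → 𝟙[ a ∈? B ] * Φ (χ∪h a)) q∣Φ∪)
                            (∣n⇒∣m*n o (vanishes J J⊆X (≤-trans (+-monoʳ-≤ ∣ J ∣ (n≤1+n k)) ∣J∣+1+k≤s)))

  vanishes-∏∈ : ∀ {B : Subset n} → SubsetOfX n B → ∀ {r} (S : Subset r) (off : Fin r → ℕ) →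
                Vanishes ∣ S ∣ (λ C → ∏∈ S (λ l → ∣ C ∩ B ∣ + off l))
  vanishes-∏∈ B⊆X []            off = vanishes-1
  vanishes-∏∈ {B} B⊆X (inside  ∷ S) off =
    vanishes-*-∣∩∣+ {h = λ C → ∏∈ S (λ l → ∣ C ∩ B ∣ + off (suc l))} (off zero) B⊆X
      (vanishes-∏∈ B⊆X S (off ∘ suc))
  vanishes-∏∈ B⊆X (outside ∷ S) off = vanishes-∏∈ B⊆X S (off ∘ suc)

  vanishes⇒∣Φ : ∀ {k h} → Vanishes k h → k ≤ s → q ∣ Φ h
  vanishes⇒∣Φ {k} {h} vanishes k≤s =
    subst (q ∣_) (Φ-cong (λ C → trans (cong (_* h C) (χ-⊥ C)) (*-identityˡ (h C))))
      (vanishes ⊥ (λ j j∈⊥ → contradiction j∈⊥ ∉⊥) (subst (λ t → t + k ≤ s) (sym (∣⊥∣≡0 n)) k≤s))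

∣∧<⇒≡0 : ∀ {d t} → d ∣ t → t < d → t ≡ 0
∣∧<⇒≡0 {t = zero}  _   _   = refl
∣∧<⇒≡0 {t = suc t} d∣t t<d = contradiction d∣t (>⇒∤ t<d)

module _ {p} .{{_ : NonZero p}} where

  %≡⇒∣+∸ : ∀ u {r} → r ≤ p → u % p ≡ r → p ∣ u + (p ∸ r)
  %≡⇒∣+∸ u {r} r≤p u%p≡r = divides (suc (u / p)) (begin
    u + (p ∸ r)                  ≡⟨ cong (_+ (p ∸ r)) (m≡m%n+[m/n]*n u p) ⟩
    u % p + u / p * p + (p ∸ r)  ≡⟨ cong (λ t → t + u / p * p + (p ∸ r)) u%p≡r ⟩
    r + u / p * p + (p ∸ r)      ≡⟨ [x+y]+z≡[x+z]+y r (u / p * p) (p ∸ r) ⟩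
    r + (p ∸ r) + u / p * p      ≡⟨ cong (_+ u / p * p) (m+[n∸m]≡n r≤p) ⟩
    p + u / p * p                ∎)

  ∣+∸⇒%≡ : ∀ u {r} → r < p → p ∣ u + (p ∸ r) → u % p ≡ r
  ∣+∸⇒%≡ u {r} r<p p∣u+p∸r = begin
    u % p                  ≡⟨ [m+n]%n≡m%n u p ⟨
    (u + p) % p            ≡⟨ cong (λ t → (u + t) % p) (m∸n+n≡m (<⇒≤ r<p)) ⟨
    (u + (p ∸ r + r)) % p  ≡⟨ cong (_% p) (+-assoc u (p ∸ r) r) ⟨
    (u + (p ∸ r) + r) % p  ≡⟨ %-remove-+ˡ r p∣u+p∸r ⟩
    r % p                  ≡⟨ m<n⇒m%n≡m r<p ⟩
    r                      ∎

linForm≡Φχ : ∀ {n m p} (A : Fin m → Subset n) (x : Fin m → Fin p) (I : Subset n) →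
             linForm A x I ≡ Weighted.Φ (toℕ ∘ x) A (χ I)
linForm≡Φχ {m = m} A x I =
  trans (sumFin≡∑ m (λ i → if does (I ⊆? A i) then toℕ (x i) else 0))
        (sum-cong-≗ (λ i → if-then-else-0 (does (I ⊆? A i)) (toℕ (x i))))
  where
  if-then-else-0 : ∀ b t → (if b then t else 0) ≡ t * (if b then 1 else 0)
  if-then-else-0 true  t = sym (*-identityʳ t)
  if-then-else-0 false t = sym (*-zeroʳ t)

module Separation {p} .{{_ : NonZero p}} (p-prime : Prime p)
  {L K : Subset p} (L∩K=∅ : ∀ l → l ∈ L → l ∉ K)
  {n m} (A : Fin m → Subset n)
  (∣A∣∈K : ∀ i → ∃ λ k → k ∈ K × toℕ k ≡ ∣ A i ∣ % p)
  (∣A∩A∣∈L : ∀ i j → i ≢ j → ∃ λ l → l ∈ L × toℕ l ≡ ∣ A i ∩ A j ∣ % p)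
  (x : Fin m → Fin p)
  (L_I≡0 : ∀ I → SubsetOfX n I → ∣ I ∣ ≤ ∣ L ∣ → p ∣ linForm A x I) where

  open Vanishing (toℕ ∘ x) A ∣ L ∣ (λ I I⊆X ∣I∣≤s → subst (p ∣_) (linForm≡Φχ A x I) (L_I≡0 I I⊆X ∣I∣≤s))

  x≡0-if-∩-shifted : ∀ j (B : Subset n) c → SubsetOfX n B →
                     (∀ i → toℕ (x i) ≡ 0 ⊎ ∣ A i ∩ A j ∣ ≡ ∣ A i ∩ B ∣ + c) → toℕ (x j) ≡ 0
  x≡0-if-∩-shifted j B c B⊆X shifted with shifted j
  ... | inj₁ xⱼ≡0              = xⱼ≡0
  ... | inj₂ ∣Aⱼ∩Aⱼ∣≡∣Aⱼ∩B∣+c = ∣∧<⇒≡0 p∣xⱼ (toℕ<n (x j))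
    where
    -- p ∸ l stands for −l modulo p.
    factor : Subset n → Fin p → ℕ
    factor C l = ∣ C ∩ B ∣ + (c + (p ∸ toℕ l))

    F : Subset n → ℕ
    F C = ∏∈ L (factor C)

    p∣factor : ∀ C l → (∣ C ∩ B ∣ + c) % p ≡ toℕ l → p ∣ factor C l
    p∣factor C l ≡l = subst (p ∣_) (+-assoc ∣ C ∩ B ∣ c (p ∸ toℕ l)) (%≡⇒∣+∸ _ (<⇒≤ (toℕ<n l)) ≡l)

    p∣factor⇒ : ∀ C l → p ∣ factor C l → (∣ C ∩ B ∣ + c) % p ≡ toℕ l
    p∣factor⇒ C l p∣ = ∣+∸⇒%≡ _ (toℕ<n l) (subst (p ∣_) (sym (+-assoc ∣ C ∩ B ∣ c (p ∸ toℕ l))) p∣)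

    p∣xF[A] : ∀ i → i ≢ j → p ∣ toℕ (x i) * F (A i)
    p∣xF[A] i i≢j with shifted i | ∣A∩A∣∈L i j i≢j
    ... | inj₁ xᵢ≡0           | _ = subst (λ t → p ∣ t * F (A i)) (sym xᵢ≡0) (p ∣0)
    ... | inj₂ ∣Aᵢ∩Aⱼ∣≡∣Aᵢ∩B∣+c | l , l∈L , l≡∣Aᵢ∩Aⱼ∣%p =
      ∣n⇒∣m*n (toℕ (x i)) (∣∏∈ (factor (A i)) l∈L
        (p∣factor (A i) l (trans (cong (_% p) (sym ∣Aᵢ∩Aⱼ∣≡∣Aᵢ∩B∣+c)) (sym l≡∣Aᵢ∩Aⱼ∣%p))))

    p∤F[Aⱼ] : p ∤ F (A j)
    p∤F[Aⱼ] = prime∤∏∈ p-prime L (factor (A j)) p∤factor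
      where
      p∤factor : ∀ l → l ∈ L → p ∤ factor (A j) l
      p∤factor l l∈L p∣factor with ∣A∣∈K j
      ... | k , k∈K , k≡∣Aⱼ∣%p = L∩K=∅ l l∈L (subst (_∈ K) (toℕ-injective k≡l) k∈K)
        where
        k≡l : toℕ k ≡ toℕ l
        k≡l = begin
          toℕ k                  ≡⟨ k≡∣Aⱼ∣%p ⟩
          ∣ A j ∣ % p            ≡⟨ cong (λ C → ∣ C ∣ % p) (∩-idem (A j)) ⟨
          ∣ A j ∩ A j ∣ % p      ≡⟨ cong (_% p) ∣Aⱼ∩Aⱼ∣≡∣Aⱼ∩B∣+c ⟩
          (∣ A j ∩ B ∣ + c) % p  ≡⟨ p∣factor⇒ (A j) l p∣factor ⟩
          toℕ l                  ∎

    p∣ΦF : p ∣ ∑[ i < m ] (toℕ (x i) * F (A i))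
    p∣ΦF = vanishes⇒∣Φ {h = F} (vanishes-∏∈ B⊆X L (λ l → c + (p ∸ toℕ l))) ≤-refl

    p∣xⱼ : p ∣ toℕ (x j)
    p∣xⱼ = [ id , (λ p∣F → contradiction p∣F p∤F[Aⱼ]) ]
             (euclidsLemma (toℕ (x j)) (F (A j)) p-prime
               (∣-∑⇒∣-term (λ i → toℕ (x i) * F (A i)) j p∣xF[A] p∣ΦF))

  x≡0-if-SubsetOfX : ∀ j → SubsetOfX n (A j) → toℕ (x j) ≡ 0
  x≡0-if-SubsetOfX j Aⱼ⊆X = x≡0-if-∩-shifted j (A j) 0 Aⱼ⊆X (λ i → inj₂ (sym (+-identityʳ _)))

proposition2p1 : (p : ℕ) → .{{_ : NonZero p}} → Prime p →
    (L K : Subset p) → (∀ l → l ∈ L → l ∉ K) →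
    (n m : ℕ) → (A : Fin m → Subset n) →
    (∀ i → ∃ λ k → k ∈ K × toℕ k ≡ ∣ A i ∣ % p) →
    (∀ i j → i ≢ j → ∃ λ l → l ∈ L × toℕ l ≡ ∣ A i ∩ A j ∣ % p) →
    (x : Fin m → Fin p) →
    (∀ (I : Subset n) → SubsetOfX n I → ∣ I ∣ ≤ ∣ L ∣ → p ∣ linForm A x I) →
    ∀ i → toℕ (x i) ≡ 0
proposition2p1 p p-prime L K L∩K=∅ zero m A ∣A∣∈K ∣A∩A∣∈L x L_I≡0 j =
  Separation.x≡0-if-SubsetOfX p-prime L∩K=∅ A ∣A∣∈K ∣A∩A∣∈L x L_I≡0 j (λ ())
proposition2p1 p p-prime L K L∩K=∅ (suc k) m A ∣A∣∈K ∣A∩A∣∈L x L_I≡0 = x≡0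
  where
  open Separation p-prime L∩K=∅ A ∣A∣∈K ∣A∩A∣∈L x L_I≡0

  x≡0-if-last∉ : ∀ j → fromℕ k ∉ A j → toℕ (x j) ≡ 0
  x≡0-if-last∉ j last∉Aⱼ = x≡0-if-SubsetOfX j (fromℕ∉⇒SubsetOfX last∉Aⱼ)

  x≡0 : ∀ j → toℕ (x j) ≡ 0
  x≡0 j with fromℕ k ∈? A j
  ... | no  last∉Aⱼ = x≡0-if-last∉ j last∉Aⱼ
  ... | yes last∈Aⱼ =
    x≡0-if-∩-shifted j (A j - fromℕ k) 1 (fromℕ∉⇒SubsetOfX (x∉p-x (A j) (fromℕ k))) shifted
    where
    shifted : ∀ i → toℕ (x i) ≡ 0 ⊎ ∣ A i ∩ A j ∣ ≡ ∣ A i ∩ (A j - fromℕ k) ∣ + 1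
    shifted i with fromℕ k ∈? A i
    ... | no  last∉Aᵢ = inj₁ (x≡0-if-last∉ i last∉Aᵢ)
    ... | yes last∈Aᵢ = inj₂ (trans (∣p∩q∣≡1+∣p∩[q-x]∣ last∈Aᵢ last∈Aⱼ) (+-comm 1 _))
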